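{- Let $N_{pq}(t)$ be the polynomials defined by the recursion below. Then for all nonnegative integers $p,q$, $$N_{pq}(t)=\sum_{k=1}^{\min\{p,q\}}\mathrm{S}_\ominus(k,p-k\mid k,q-k)\,t^k.$$
   Context: For nonnegative integers $p,q$ let $W_{pq}(t)=\sum_{k=0}^{\min\{p,q\}-1}\binom{p-1}{k}\binom{q-1}{k}t^k$. Define polynomials $N_{pq}=N_{pq}(t)$ for nonnegative integers $p,q$ by $N_{0,q}=N_{p,0}=N_{1,1}=0$ and, for $p,q\ge1$ with $(p,q)\neq(1,1)$, $$N_{pq}=N_{p-1,q}+N_{p,q-1}-(1-t)N_{p-1,q-1}+|p-q|\,t\,W_{pq}.$$ A partition is identified with its Young diagram (a left-justified array of boxes whose row lengths, from top to bottom, are the parts), viewed as a finite set of boxes. For nonnegative integers $a,b$, $\mathrm{Par}(a\times b)$ denotes the set of Young diagrams fitting inside a rectangle with $a$ rows and $b$ columns (including the empty diagram). For Young diagrams $\lambda,\mu$, $\lambda\ominus\mu=(\lambda\cup\mu)\setminus(\lambda\cap\mu)$ is the set of boxes lying in exactly one of them, and $$\mathrm{S}_\ominus(a,b\mid c,d)=\sum_{\lambda\in\mathrm{Par}(a\times b),\ \mu\in\mathrm{Par}(c\times d)}|\lambda\ominus\mu|.$$ -}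

module Defs where

open import Data.Bool using (Bool; true; false; if_then_else_; _xor_; _∧_)
open import Data.Nat as ℕ using (ℕ; zero; suc; _∸_; _⊔_; _⊓_; _<ᵇ_; _≤ᵇ_; _≡ᵇ_; ∣_-_∣)
open import Data.Nat.Combinatorics using (_C_)
open import Data.Integer as ℤ using (ℤ; +_)
open import Data.List using (List; []; _∷_; map; concatMap; upTo; filterᵇ; foldr)
open import Data.Nat.ListAction using (sum)

-- Polynomials in t with integer coefficients, as coefficient sequences:
-- a polynomial P is represented by k ↦ (coefficient of t^k in P).

Poly : Set
Poly = ℕ → ℤ

0ₚ : Poly
0ₚ _ = + 0

_+ₚ_ : Poly → Poly → Poly
(f +ₚ g) k = f k ℤ.+ g k

_-ₚ_ : Poly → Poly → Poly
(f -ₚ g) k = f k ℤ.- g k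

_·ₚ_ : ℕ → Poly → Poly
(n ·ₚ f) k = + n ℤ.* f k

t·ₚ : Poly → Poly
t·ₚ f zero = + 0
t·ₚ f (suc k) = f k

1-t·ₚ : Poly → Poly
1-t·ₚ f = f -ₚ t·ₚ f

mono : ℕ → ℤ → Poly
mono j c k = if j ≡ᵇ k then c else + 0

W : ℕ → ℕ → Poly
W p q k = if k <ᵇ (p ⊓ q) then + (((p ∸ 1) C k) ℕ.* ((q ∸ 1) C k)) else + 0

N : ℕ → ℕ → Poly
N zero q = 0ₚ
N (suc p) zero = 0ₚ
N (suc zero) (suc zero) = 0ₚ
N (suc p) (suc q) =
  ((N p (suc q) +ₚ N (suc p) q) -ₚ 1-t·ₚ (N p q))
    +ₚ (∣ suc p - suc q ∣ ·ₚ t·ₚ (W (suc p) (suc q)))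

-- Young diagrams in an a × b rectangle, represented by their list of
-- a row lengths (padded with zeros), weakly decreasing, each ≤ b.

allRows : ℕ → ℕ → List (List ℕ)
allRows zero b = [] ∷ []
allRows (suc a) b = concatMap (λ x → map (x ∷_) (allRows a b)) (upTo (suc b))

nonincreasing : List ℕ → Bool
nonincreasing [] = true
nonincreasing (x ∷ []) = true
nonincreasing (x ∷ y ∷ xs) = (y ≤ᵇ x) ∧ nonincreasing (y ∷ xs)

Par : ℕ → ℕ → List (List ℕ)
Par a b = filterᵇ nonincreasing (allRows a b)

-- length of row i (0-indexed); 0 beyond the listed rows
row : List ℕ → ℕ → ℕ
row [] i = 0
row (x ∷ xs) zero = x
row (x ∷ xs) (suc i) = row xs i

-- box (i , j) (row i, column j, 0-indexed) belongs to the diagram λ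
_∋box_,_ : List ℕ → ℕ → ℕ → Bool
λ′ ∋box i , j = j <ᵇ row λ′ i

symDiffIn : ℕ → ℕ → List ℕ → List ℕ → ℕ
symDiffIn R C λ′ μ =
  sum (map (λ i → sum (map (λ j → if (λ′ ∋box i , j) xor (μ ∋box i , j) then 1 else 0)
                           (upTo C)))
           (upTo R))

-- S_⊖(a,b | c,d) = Σ_{λ ∈ Par(a×b), μ ∈ Par(c×d)} |λ ⊖ μ|.
-- All boxes of λ (resp. μ) lie in rows < a (resp. c) and columns < b (resp. d),
-- so |λ ⊖ μ| = symDiffIn (a ⊔ c) (b ⊔ d) λ μ.
S⊖ : ℕ → ℕ → ℕ → ℕ → ℕ
S⊖ a b c d =
  sum (map (λ λ′ → sum (map (λ μ → symDiffIn (a ⊔ c) (b ⊔ d) λ′ μ) (Par c d))) (Par a b))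

sumₚ : List Poly → Poly
sumₚ = foldr _+ₚ_ 0ₚ

RHS : ℕ → ℕ → Poly
RHS p q = sumₚ (map (λ i → mono (suc i) (+ S⊖ (suc i) (p ∸ suc i) (suc i) (q ∸ suc i)))
                    (upTo (p ⊓ q)))

{-# OPTIONS --safe #-}
-- Split a pair (λ, μ) of k-row diagrams by their first rows x, y: the first rows contribute |x − y| boxes
-- to λ ⊖ μ for every pair of remaining rows, and these range over the (k−1)-row diagrams with parts at most
-- x resp. y, of which there are C(k−1+x, k−1) resp. C(k−1+y, k−1). So S⊖(k,a|k,b) is a rectangular sum
-- over x ≤ a, y ≤ b, and the coefficient of t^(j+1) on the right is the sum of
--   g(x, y) = |x − y| C(j+x, j) C(j+y, j) + S⊖(j, x | j, y)
-- over x < p − j, y < q − j. The mixed second difference in (p, q) of such a rectangular sum is its corner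
-- term g(p − j, q − j) = |p − q| C(p, j) C(q, j) + [t^j] RHS(p, q), which is the recursion defining N.
module Submission where

open import Defs
open import Data.Bool using (Bool; true; false; if_then_else_; _xor_; _∧_)
open import Data.Bool.Properties using (xor-identityʳ; if-float)
open import Data.Nat
  using (ℕ; zero; suc; _+_; _*_; _∸_; _⊓_; _<ᵇ_; _≤ᵇ_; _≡ᵇ_; ∣_-_∣; _≤_; _<_; s≤s; z<s)
open import Data.Nat.Properties
open import Data.Nat.Combinatorics using (_C_; nCn≡1; nCk+nC[k+1]≡[n+1]C[k+1])
open import Data.Nat.ListAction using (sum)
open import Data.Nat.ListAction.Properties using (sum-++)
open import Data.Nat.Tactic.RingSolver using (solve-∀)
open import Data.Integer as ℤ using (ℤ)
import Data.Integer.Properties as ℤ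
open import Data.Integer.Tactic.RingSolver as ℤSolver using ()
open import Data.List
  using (List; []; _∷_; _++_; [_]; map; concat; concatMap; upTo; filterᵇ; length)
open import Data.List.Properties
  using ( map-++; map-∘; map-cong; map-cong-local; map-upTo; map-applyUpTo; upTo-∷ʳ
        ; concatMap-++; ++-identityʳ; filter-++ )
open import Data.List.Relation.Unary.All.Properties using (applyUpTo⁺₁)
open import Data.Sum as Sum using (_⊎_; inj₁; inj₂)
open import Data.Product using (_,_)
open import Function using (_∘_; id)
open import Relation.Binary.Definitions using (tri<; tri≈; tri>)
open import Relation.Binary.PropositionalEquality hiding ([_])
open import Relation.Nullary.Decidable using (Dec; yes; no; T?; dec-true; dec-false)

private
  variable
    A B : Set

∑ : List A → (A → ℕ) → ℕ
∑ xs f = sum (map f xs)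

∑< : ℕ → (ℕ → ℕ) → ℕ
∑< n = ∑ (upTo n)

infixr 6.4 ∑ ∑<
syntax ∑ xs (λ x → e) = ∑[ x ∈ xs ] e
syntax ∑< n (λ i → e) = ∑[ i < n ] e

∑-cong : {f g : A → ℕ} → (∀ x → f x ≡ g x) → ∀ xs → ∑ xs f ≡ ∑ xs g
∑-cong f≗g xs = cong sum (map-cong f≗g xs)

∑-++ : ∀ xs ys (f : A → ℕ) → ∑ (xs ++ ys) f ≡ ∑ xs f + ∑ ys f
∑-++ xs ys f = trans (cong sum (map-++ f xs ys)) (sum-++ (map f xs) (map f ys))

∑-map : ∀ (g : A → B) xs (f : B → ℕ) → ∑ (map g xs) f ≡ ∑ xs (f ∘ g)
∑-map g xs f = cong sum (sym (map-∘ xs))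

∑-concatMap : ∀ (h : A → List B) xs (f : B → ℕ) →
  ∑ (concatMap h xs) f ≡ ∑[ x ∈ xs ] ∑ (h x) f
∑-concatMap h []       f = refl
∑-concatMap h (x ∷ xs) f =
  trans (∑-++ (h x) (concatMap h xs) f) (cong (∑ (h x) f +_) (∑-concatMap h xs f))

∑-+ : ∀ xs (f g : A → ℕ) → ∑[ x ∈ xs ] (f x + g x) ≡ ∑ xs f + ∑ xs g
∑-+ []       f g = refl
∑-+ (x ∷ xs) f g = trans (cong (f x + g x +_) (∑-+ xs f g)) (interchange (f x) (g x) _ _)
  where
  interchange : ∀ a b c d → a + b + (c + d) ≡ a + c + (b + d)
  interchange = solve-∀

∑-const : ∀ (xs : List A) c → ∑[ _ ∈ xs ] c ≡ c * length xs
∑-const []       c = sym (*-zeroʳ c)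
∑-const (x ∷ xs) c = trans (cong (c +_) (∑-const xs c)) (sym (*-suc c (length xs)))

∑-1≡length : ∀ (xs : List A) → ∑[ _ ∈ xs ] 1 ≡ length xs
∑-1≡length xs = trans (∑-const xs 1) (*-identityˡ (length xs))

∑-swap : ∀ xs ys (f : A → B → ℕ) →
  ∑[ x ∈ xs ] ∑[ y ∈ ys ] f x y ≡ ∑[ y ∈ ys ] ∑[ x ∈ xs ] f x y
∑-swap []       ys f = sym (∑-const ys 0)
∑-swap (x ∷ xs) ys f =
  trans (cong (∑ ys (f x) +_) (∑-swap xs ys f)) (sym (∑-+ ys (f x) λ y → ∑[ x ∈ xs ] f x y))

∑∑-const+ : ∀ (xs : List A) (ys : List B) c (f : A → B → ℕ) →
  ∑[ x ∈ xs ] ∑[ y ∈ ys ] (c + f x y)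
    ≡ c * (length xs * length ys) + ∑[ x ∈ xs ] ∑[ y ∈ ys ] f x y
∑∑-const+ xs ys c f = begin
  ∑[ x ∈ xs ] ∑[ y ∈ ys ] (c + f x y)          ≡⟨ ∑-cong (λ x → ∑-+ ys (λ _ → c) (f x)) xs ⟩
  ∑[ x ∈ xs ] (∑[ _ ∈ ys ] c + ∑ ys (f x))     ≡⟨ ∑-+ xs _ _ ⟩
  ∑[ x ∈ xs ] ∑[ _ ∈ ys ] c + rest              ≡⟨ cong (_+ rest) (∑-cong (λ _ → ∑-const ys c) xs) ⟩
  ∑[ _ ∈ xs ] (c * length ys) + rest            ≡⟨ cong (_+ rest) (∑-const xs (c * length ys)) ⟩
  c * length ys * length xs + rest              ≡⟨ cong (_+ rest) (rearrange c (length ys) (length xs)) ⟩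
  c * (length xs * length ys) + rest            ∎
  where
  open ≡-Reasoning
  rest = ∑[ x ∈ xs ] ∑ ys (f x)
  rearrange : ∀ a b d → a * b * d ≡ a * (d * b)
  rearrange = solve-∀

map-upTo-cong : ∀ n {f g : ℕ → A} → (∀ {i} → i < n → f i ≡ g i) → map f (upTo n) ≡ map g (upTo n)
map-upTo-cong n {f} {g} f≡g = map-cong-local (applyUpTo⁺₁ {P = λ i → f i ≡ g i} id n f≡g)

∑<-cong : ∀ n {f g : ℕ → ℕ} → (∀ {i} → i < n → f i ≡ g i) → ∑< n f ≡ ∑< n g
∑<-cong n f≡g = cong sum (map-upTo-cong n f≡g)

∑<-suc : ∀ n (f : ℕ → ℕ) → ∑[ i < suc n ] f i ≡ ∑[ i < n ] f i + f n
∑<-suc n f = begin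
  ∑ (upTo (suc n)) f          ≡⟨ cong (λ is → ∑ is f) (sym (upTo-∷ʳ n)) ⟩
  ∑ (upTo n ++ [ n ]) f       ≡⟨ ∑-++ (upTo n) [ n ] f ⟩
  ∑ (upTo n) f + (f n + 0)    ≡⟨ cong (∑ (upTo n) f +_) (+-identityʳ (f n)) ⟩
  ∑ (upTo n) f + f n          ∎
  where open ≡-Reasoning

∑<-sucˡ : ∀ n (f : ℕ → ℕ) → ∑[ i < suc n ] f i ≡ f 0 + ∑[ i < n ] f (suc i)
∑<-sucˡ n f =
  cong (λ fs → f 0 + sum fs) (trans (map-applyUpTo suc f n) (sym (map-upTo (f ∘ suc) n)))

box : (ℕ → ℕ → ℕ) → ℕ → ℕ → ℕ
box g m n = ∑[ x < m ] ∑[ y < n ] g x y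

box-inclusion-exclusion : ∀ g m n →
  box g (suc m) (suc n) + box g m n ≡ box g m (suc n) + box g (suc m) n + g m n
box-inclusion-exclusion g m n = begin
  box g (suc m) (suc n) + box g m n
    ≡⟨ cong (_+ b) (trans (∑<-suc m _) (cong₂ _+_ lastColumn (∑<-suc n (g m)))) ⟩
  b + c + (r + g m n) + b
    ≡⟨ shuffle b c r (g m n) ⟩
  b + c + (b + r) + g m n
    ≡⟨ cong₂ (λ u v → u + v + g m n) (sym lastColumn) (sym (∑<-suc m _)) ⟩
  box g m (suc n) + box g (suc m) n + g m n ∎
  where
  open ≡-Reasoning
  b = box g m n
  c = ∑[ x < m ] g x n
  r = ∑[ y < n ] g m y
  lastColumn : box g m (suc n) ≡ b + c
  lastColumn = trans (∑-cong (λ x → ∑<-suc n (g x)) (upTo m)) (∑-+ (upTo m) _ _)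
  shuffle : ∀ b c r z → b + c + (r + z) + b ≡ b + c + (b + r) + z
  shuffle = solve-∀

hockey-stick : ∀ k x → ∑[ y < suc x ] (k + y) C k ≡ (suc k + x) C suc k
hockey-stick k zero rewrite +-identityʳ k =
  trans (+-identityʳ (k C k)) (trans (nCn≡1 k) (sym (nCn≡1 (suc k))))
hockey-stick k (suc x) = begin
  ∑[ y < suc (suc x) ] (k + y) C k            ≡⟨ ∑<-suc (suc x) (λ y → (k + y) C k) ⟩
  ∑[ y < suc x ] (k + y) C k + n C k          ≡⟨ cong (_+ n C k) (hockey-stick k x) ⟩
  (suc k + x) C suc k + n C k                 ≡⟨ cong (λ m → m C suc k + n C k) (sym (+-suc k x)) ⟩
  n C suc k + n C k                           ≡⟨ +-comm (n C suc k) (n C k) ⟩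
  n C k + n C suc k                           ≡⟨ nCk+nC[k+1]≡[n+1]C[k+1] n k ⟩
  suc n C suc k                               ∎
  where
  open ≡-Reasoning
  n = k + suc x

filterᵇ-concatMap : ∀ (p : B → Bool) (h : A → List B) xs →
  filterᵇ p (concatMap h xs) ≡ concatMap (filterᵇ p ∘ h) xs
filterᵇ-concatMap p h []       = refl
filterᵇ-concatMap p h (x ∷ xs) =
  trans (filter-++ (T? ∘ p) (h x) (concatMap h xs)) (cong (filterᵇ p (h x) ++_) (filterᵇ-concatMap p h xs))

filterᵇ-map : ∀ (p : B → Bool) (f : A → B) xs → filterᵇ p (map f xs) ≡ map f (filterᵇ (p ∘ f) xs)
filterᵇ-map p f [] = refl
filterᵇ-map p f (x ∷ xs) with p (f x)
... | true  = cong (f x ∷_) (filterᵇ-map p f xs)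
... | false = filterᵇ-map p f xs

filterᵇ-guard : ∀ b (p : A → Bool) xs →
  filterᵇ (λ x → b ∧ p x) xs ≡ (if b then filterᵇ p xs else [])
filterᵇ-guard true  p xs       = refl
filterᵇ-guard false p []       = refl
filterᵇ-guard false p (x ∷ xs) = filterᵇ-guard false p xs

concatMap-upTo-truncate : ∀ (G : ℕ → List A) {x n} → x < n →
  concatMap (λ y → if y ≤ᵇ x then G y else []) (upTo n) ≡ concatMap G (upTo (suc x))
concatMap-upTo-truncate G {x} {suc n} x<1+n with m<1+n⇒m<n∨m≡n x<1+n
... | inj₁ x<n = begin
  concatMap G≤ (upTo (suc n))         ≡⟨ cong (concatMap G≤) (sym (upTo-∷ʳ n)) ⟩
  concatMap G≤ (upTo n ++ [ n ])      ≡⟨ concatMap-++ G≤ (upTo n) [ n ] ⟩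
  concatMap G≤ (upTo n) ++ G≤ n ++ [] ≡⟨ cong (λ ys → concatMap G≤ (upTo n) ++ ys ++ []) lastEmpty ⟩
  concatMap G≤ (upTo n) ++ []         ≡⟨ ++-identityʳ _ ⟩
  concatMap G≤ (upTo n)               ≡⟨ concatMap-upTo-truncate G x<n ⟩
  concatMap G (upTo (suc x))          ∎
  where
  open ≡-Reasoning
  G≤ : ℕ → List _
  G≤ y = if y ≤ᵇ x then G y else []
  lastEmpty : G≤ n ≡ []
  lastEmpty = cong (λ b → if b then G n else []) (dec-false (n ≤? x) (<⇒≱ x<n))
... | inj₂ refl = cong concat (map-upTo-cong (suc x) λ {y} y<1+x →
  cong (λ b → if b then G y else []) (dec-true (y ≤? x) (≤-pred y<1+x)))

Partitions : ℕ → ℕ → List (List ℕ)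
Partitions zero    x = [ [] ]
Partitions (suc k) x = concatMap (λ y → map (y ∷_) (Partitions k y)) (upTo (suc x))

headBounded : ℕ → List ℕ → Bool
headBounded x ys = nonincreasing (x ∷ ys)

filter-headBounded : ∀ k {x b} → x ≤ b → filterᵇ (headBounded x) (allRows k b) ≡ Partitions k x
filter-headBounded zero    _ = refl
filter-headBounded (suc k) {x} {b} x≤b = begin
  filterᵇ (headBounded x) (concatMap (λ y → map (y ∷_) (allRows k b)) (upTo (suc b)))
    ≡⟨ filterᵇ-concatMap (headBounded x) (λ y → map (y ∷_) (allRows k b)) (upTo (suc b)) ⟩
  concatMap (λ y → filterᵇ (headBounded x) (map (y ∷_) (allRows k b))) (upTo (suc b))
    ≡⟨ cong concat (map-upTo-cong (suc b) firstRow) ⟩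
  concatMap (λ y → if y ≤ᵇ x then map (y ∷_) (Partitions k y) else []) (upTo (suc b))
    ≡⟨ concatMap-upTo-truncate (λ y → map (y ∷_) (Partitions k y)) (s≤s x≤b) ⟩
  Partitions (suc k) x ∎
  where
  open ≡-Reasoning
  firstRow : ∀ {y} → y < suc b →
    filterᵇ (headBounded x) (map (y ∷_) (allRows k b))
      ≡ (if y ≤ᵇ x then map (y ∷_) (Partitions k y) else [])
  firstRow {y} y<1+b = begin
    filterᵇ (headBounded x) (map (y ∷_) (allRows k b))
      ≡⟨ filterᵇ-map (headBounded x) (y ∷_) (allRows k b) ⟩
    map (y ∷_) (filterᵇ (λ ys → (y ≤ᵇ x) ∧ headBounded y ys) (allRows k b))
      ≡⟨ cong (map (y ∷_)) (filterᵇ-guard (y ≤ᵇ x) (headBounded y) (allRows k b)) ⟩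
    map (y ∷_) (if y ≤ᵇ x then filterᵇ (headBounded y) (allRows k b) else [])
      ≡⟨ cong (λ ps → map (y ∷_) (if y ≤ᵇ x then ps else [])) (filter-headBounded k (≤-pred y<1+b)) ⟩
    map (y ∷_) (if y ≤ᵇ x then Partitions k y else [])
      ≡⟨ if-float (map (y ∷_)) (y ≤ᵇ x) ⟩
    (if y ≤ᵇ x then map (y ∷_) (Partitions k y) else []) ∎

Par≡Partitions : ∀ k b → Par k b ≡ Partitions k b
Par≡Partitions zero    b = refl
Par≡Partitions (suc k) b =
  trans (filterᵇ-concatMap nonincreasing (λ y → map (y ∷_) (allRows k b)) (upTo (suc b)))
        (cong concat (map-upTo-cong (suc b) λ {y} y<1+b →
          trans (filterᵇ-map nonincreasing (y ∷_) (allRows k b))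
                (cong (map (y ∷_)) (filter-headBounded k (≤-pred y<1+b)))))

∑-Partitions-suc : ∀ k x (f : List ℕ → ℕ) →
  ∑ (Partitions (suc k) x) f ≡ ∑[ y < suc x ] ∑[ ν ∈ Partitions k y ] f (y ∷ ν)
∑-Partitions-suc k x f =
  trans (∑-concatMap (λ y → map (y ∷_) (Partitions k y)) (upTo (suc x)) f)
        (∑-cong (λ y → ∑-map (y ∷_) (Partitions k y) f) (upTo (suc x)))

length-Partitions : ∀ k x → length (Partitions k x) ≡ (k + x) C k
length-Partitions zero    x = refl
length-Partitions (suc k) x = begin
  length (Partitions (suc k) x)              ≡⟨ sym (∑-1≡length (Partitions (suc k) x)) ⟩
  ∑[ _ ∈ Partitions (suc k) x ] 1            ≡⟨ ∑-Partitions-suc k x (λ _ → 1) ⟩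
  ∑[ y < suc x ] ∑[ _ ∈ Partitions k y ] 1   ≡⟨ ∑-cong (∑-1≡length ∘ Partitions k) (upTo (suc x)) ⟩
  ∑[ y < suc x ] length (Partitions k y)     ≡⟨ ∑-cong (length-Partitions k) (upTo (suc x)) ⟩
  ∑[ y < suc x ] (k + y) C k                 ≡⟨ hockey-stick k x ⟩
  (suc k + x) C suc k                        ∎
  where open ≡-Reasoning

𝟙 : Bool → ℕ
𝟙 b = if b then 1 else 0

∑-𝟙-<ᵇ : ∀ {w y} → y ≤ w → ∑[ j < w ] 𝟙 (j <ᵇ y) ≡ y
∑-𝟙-<ᵇ {w}     {zero}  _         = ∑-const (upTo w) 0
∑-𝟙-<ᵇ {suc w} {suc y} (s≤s y≤w) =
  trans (∑<-sucˡ w λ j → 𝟙 (j <ᵇ suc y)) (cong suc (∑-𝟙-<ᵇ y≤w))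

∑-𝟙-xor : ∀ {w x y} → x ≤ w → y ≤ w → ∑[ j < w ] 𝟙 ((j <ᵇ x) xor (j <ᵇ y)) ≡ ∣ x - y ∣
∑-𝟙-xor {w}     {zero}  {y}     _         y≤w       = ∑-𝟙-<ᵇ y≤w
∑-𝟙-xor {suc w} {suc x} {zero}  (s≤s x≤w) _         = begin
  ∑[ j < suc w ] 𝟙 ((j <ᵇ suc x) xor (j <ᵇ 0))
    ≡⟨ ∑<-sucˡ w (λ j → 𝟙 ((j <ᵇ suc x) xor (j <ᵇ 0))) ⟩
  suc (∑[ j < w ] 𝟙 ((j <ᵇ x) xor false))
    ≡⟨ cong suc (∑-cong (cong 𝟙 ∘ xor-identityʳ ∘ (_<ᵇ x)) (upTo w)) ⟩
  suc (∑[ j < w ] 𝟙 (j <ᵇ x))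
    ≡⟨ cong suc (∑-𝟙-<ᵇ x≤w) ⟩
  suc x ∎
  where open ≡-Reasoning
∑-𝟙-xor {suc w} {suc x} {suc y} (s≤s x≤w) (s≤s y≤w) =
  trans (∑<-sucˡ w λ j → 𝟙 ((j <ᵇ suc x) xor (j <ᵇ suc y))) (∑-𝟙-xor x≤w y≤w)

symDiffIn-∷ : ∀ k {w x y} → x ≤ w → y ≤ w → ∀ λ′ μ →
  symDiffIn (suc k) w (x ∷ λ′) (y ∷ μ) ≡ ∣ x - y ∣ + symDiffIn k w λ′ μ
symDiffIn-∷ k {w} x≤w y≤w λ′ μ =
  trans (∑<-sucˡ k _) (cong (_+ symDiffIn k w λ′ μ) (∑-𝟙-xor x≤w y≤w))

symDiffTotal : ℕ → ℕ → ℕ → ℕ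
symDiffFirstRows : ℕ → ℕ → ℕ → ℕ

symDiffTotal zero    a b = 0
symDiffTotal (suc k) a b = box (symDiffFirstRows k) (suc a) (suc b)

symDiffFirstRows k x y =
  ∣ x - y ∣ * (length (Partitions k x) * length (Partitions k y)) + symDiffTotal k x y

∑∑symDiffIn≡symDiffTotal : ∀ k {a b w} → a ≤ w → b ≤ w →
  ∑[ λ′ ∈ Partitions k a ] ∑[ μ ∈ Partitions k b ] symDiffIn k w λ′ μ ≡ symDiffTotal k a b
∑∑symDiffIn≡symDiffTotal zero    _ _ = refl
∑∑symDiffIn≡symDiffTotal (suc k) {a} {b} {w} a≤w b≤w = begin
  ∑[ λ′ ∈ Partitions (suc k) a ] ∑[ μ ∈ Partitions (suc k) b ] symDiffIn (suc k) w λ′ μ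
    ≡⟨ ∑-Partitions-suc k a _ ⟩
  ∑[ x < suc a ] ∑[ λ′ ∈ P x ] ∑[ μ ∈ Partitions (suc k) b ] symDiffIn (suc k) w (x ∷ λ′) μ
    ≡⟨ ∑-cong (λ x → ∑-cong (λ λ′ → ∑-Partitions-suc k b _) (P x)) (upTo (suc a)) ⟩
  ∑[ x < suc a ] ∑[ λ′ ∈ P x ] ∑[ y < suc b ] ∑[ μ ∈ P y ] symDiffIn (suc k) w (x ∷ λ′) (y ∷ μ)
    ≡⟨ ∑-cong (λ x → ∑-swap (P x) (upTo (suc b)) _) (upTo (suc a)) ⟩
  ∑[ x < suc a ] ∑[ y < suc b ] ∑[ λ′ ∈ P x ] ∑[ μ ∈ P y ] symDiffIn (suc k) w (x ∷ λ′) (y ∷ μ)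
    ≡⟨ ∑<-cong (suc a) (λ x<1+a → ∑<-cong (suc b) λ y<1+b →
         firstRows (≤-trans (≤-pred x<1+a) a≤w) (≤-trans (≤-pred y<1+b) b≤w)) ⟩
  symDiffTotal (suc k) a b ∎
  where
  open ≡-Reasoning
  P = Partitions k
  firstRows : ∀ {x y} → x ≤ w → y ≤ w →
    ∑[ λ′ ∈ P x ] ∑[ μ ∈ P y ] symDiffIn (suc k) w (x ∷ λ′) (y ∷ μ) ≡ symDiffFirstRows k x y
  firstRows {x} {y} x≤w y≤w = begin
    ∑[ λ′ ∈ P x ] ∑[ μ ∈ P y ] symDiffIn (suc k) w (x ∷ λ′) (y ∷ μ)
      ≡⟨ ∑-cong (λ λ′ → ∑-cong (symDiffIn-∷ k x≤w y≤w λ′) (P y)) (P x) ⟩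
    ∑[ λ′ ∈ P x ] ∑[ μ ∈ P y ] (∣ x - y ∣ + symDiffIn k w λ′ μ)
      ≡⟨ ∑∑-const+ (P x) (P y) ∣ x - y ∣ (symDiffIn k w) ⟩
    ∣ x - y ∣ * (length (P x) * length (P y)) + ∑[ λ′ ∈ P x ] ∑[ μ ∈ P y ] symDiffIn k w λ′ μ
      ≡⟨ cong (∣ x - y ∣ * (length (P x) * length (P y)) +_) (∑∑symDiffIn≡symDiffTotal k x≤w y≤w) ⟩
    symDiffFirstRows k x y ∎

S⊖-diagonal : ∀ k a b → S⊖ k a k b ≡ symDiffTotal k a b
S⊖-diagonal k a b rewrite ⊔-idem k | Par≡Partitions k a | Par≡Partitions k b =
  ∑∑symDiffIn≡symDiffTotal k (m≤m⊔n a b) (m≤n⊔m a b)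

-- The coefficient of t^k on the right-hand side. For k = suc j it is a box sum over x < p ∸ j, y < q ∸ j,
-- so truncated subtraction makes it vanish for k > min(p,q) with no case distinction.
coeff : ℕ → ℕ → ℕ → ℕ
coeff zero    p q = 0
coeff (suc j) p q = box (symDiffFirstRows j) (p ∸ j) (q ∸ j)

coeff-vanishes : ∀ j p q → p < j ⊎ q < j → coeff j p q ≡ 0
coeff-vanishes (suc j) p q (inj₁ p<1+j) rewrite m≤n⇒m∸n≡0 (≤-pred p<1+j) = refl
coeff-vanishes (suc j) p q (inj₂ q<1+j) rewrite m≤n⇒m∸n≡0 (≤-pred q<1+j) = ∑-const (upTo (p ∸ j)) 0

m∸n≡1+[m∸1+n] : ∀ {m n} → n < m → m ∸ n ≡ suc (m ∸ suc n)
m∸n≡1+[m∸1+n] n<m = +-∸-assoc 1 n<m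

coeff≡symDiffTotal : ∀ {j p q} → j ≤ p → j ≤ q → coeff j p q ≡ symDiffTotal j (p ∸ j) (q ∸ j)
coeff≡symDiffTotal {zero}  _   _   = refl
coeff≡symDiffTotal {suc j} j<p j<q =
  cong₂ (box (symDiffFirstRows j)) (m∸n≡1+[m∸1+n] j<p) (m∸n≡1+[m∸1+n] j<q)

coeff-shift : ∀ j m n → coeff (suc j) (j + m) (j + n) ≡ box (symDiffFirstRows j) m n
coeff-shift j m n = cong₂ (box (symDiffFirstRows j)) (m+n∸m≡n j m) (m+n∸m≡n j n)

Wcoeff : ℕ → ℕ → ℕ → ℕ
Wcoeff p q j = if j <ᵇ suc (p ⊓ q) then (p C j) * (q C j) else 0

W-suc : ∀ p q j → W (suc p) (suc q) j ≡ ℤ.+ Wcoeff p q j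
W-suc p q j with j <ᵇ suc (p ⊓ q)
... | true  = refl
... | false = refl

-- The recursion for N at the coefficient of t^(suc j), with the subtracted terms moved across so that
-- it is an identity in ℕ.
CoeffRecurrence : ℕ → ℕ → ℕ → Set
CoeffRecurrence j p q =
  coeff (suc j) (suc p) (suc q) + coeff (suc j) p q
    ≡ coeff (suc j) p (suc q) + coeff (suc j) (suc p) q + coeff j p q + ∣ p - q ∣ * Wcoeff p q j

coeff-recurrence-inside : ∀ j m n → CoeffRecurrence j (j + m) (j + n)
coeff-recurrence-inside j m n = begin
  coeff (suc j) (suc (j + m)) (suc (j + n)) + coeff (suc j) (j + m) (j + n)
    ≡⟨ cong₂ _+_ corner (coeff-shift j m n) ⟩
  box g (suc m) (suc n) + box g m n
    ≡⟨ box-inclusion-exclusion g m n ⟩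
  box g m (suc n) + box g (suc m) n + (∣ m - n ∣ * (#P m * #P n) + symDiffTotal j m n)
    ≡⟨ swap-last _ (∣ m - n ∣ * (#P m * #P n)) (symDiffTotal j m n) ⟩
  box g m (suc n) + box g (suc m) n + symDiffTotal j m n + ∣ m - n ∣ * (#P m * #P n)
    ≡⟨ sym (cong₂ _+_ (cong₂ _+_ (cong₂ _+_ left right) middle) last) ⟩
  coeff (suc j) (j + m) (suc (j + n)) + coeff (suc j) (suc (j + m)) (j + n) + coeff j (j + m) (j + n)
    + ∣ j + m - j + n ∣ * Wcoeff (j + m) (j + n) j ∎
  where
  open ≡-Reasoning
  g = symDiffFirstRows j
  #P = λ x → length (Partitions j x)
  swap-last : ∀ a b c → a + (b + c) ≡ a + c + b
  swap-last = solve-∀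
  corner : coeff (suc j) (suc (j + m)) (suc (j + n)) ≡ box g (suc m) (suc n)
  corner = trans (cong₂ (coeff (suc j)) (sym (+-suc j m)) (sym (+-suc j n))) (coeff-shift j (suc m) (suc n))
  left : coeff (suc j) (j + m) (suc (j + n)) ≡ box g m (suc n)
  left = trans (cong (coeff (suc j) (j + m)) (sym (+-suc j n))) (coeff-shift j m (suc n))
  right : coeff (suc j) (suc (j + m)) (j + n) ≡ box g (suc m) n
  right = trans (cong (λ p → coeff (suc j) p (j + n)) (sym (+-suc j m))) (coeff-shift j (suc m) n)
  middle : coeff j (j + m) (j + n) ≡ symDiffTotal j m n
  middle = trans (coeff≡symDiffTotal (m≤m+n j m) (m≤m+n j n))
                 (cong₂ (symDiffTotal j) (m+n∸m≡n j m) (m+n∸m≡n j n))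
  binomials : Wcoeff (j + m) (j + n) j ≡ #P m * #P n
  binomials =
    trans (cong (λ b → if b then ((j + m) C j) * ((j + n) C j) else 0)
                (dec-true (j <? suc ((j + m) ⊓ (j + n))) (s≤s (⊓-glb (m≤m+n j m) (m≤m+n j n)))))
          (sym (cong₂ _*_ (length-Partitions j m) (length-Partitions j n)))
  last : ∣ j + m - j + n ∣ * Wcoeff (j + m) (j + n) j ≡ ∣ m - n ∣ * (#P m * #P n)
  last = cong₂ _*_ (∣m+n-m+o∣≡∣n-o∣ j m n) binomials

coeff-recurrence-outside : ∀ {j p q} → p < j ⊎ q < j → CoeffRecurrence j p q
coeff-recurrence-outside {j} {p} {q} out
  rewrite coeff-vanishes (suc j) (suc p) (suc q) (Sum.map s≤s s≤s out)
        | coeff-vanishes (suc j) p q (Sum.map m<n⇒m<1+n m<n⇒m<1+n out)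
        | coeff-vanishes (suc j) p (suc q) (Sum.map m<n⇒m<1+n s≤s out)
        | coeff-vanishes (suc j) (suc p) q (Sum.map s≤s m<n⇒m<1+n out)
        | coeff-vanishes j p q out
        | dec-false (j <? suc (p ⊓ q))
                    (<⇒≱ (Sum.[ ≤-<-trans (m⊓n≤m p q) , ≤-<-trans (m⊓n≤n p q) ] out) ∘ ≤-pred)
  = sym (*-zeroʳ ∣ p - q ∣)

coeff-recurrence : ∀ j p q → CoeffRecurrence j p q
coeff-recurrence j p q with j ≤? p | j ≤? q
... | yes j≤p | yes j≤q with m , refl ← m≤n⇒∃[o]m+o≡n j≤p | n , refl ← m≤n⇒∃[o]m+o≡n j≤q =
  coeff-recurrence-inside j m n
... | no j≰p | _      = coeff-recurrence-outside (inj₁ (≰⇒> j≰p))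
... | yes _  | no j≰q = coeff-recurrence-outside (inj₂ (≰⇒> j≰q))

ℤ-recurrence : ∀ x a b c d y → x + c ≡ a + b + d + y →
  (ℤ.+ a ℤ.+ ℤ.+ b) ℤ.- (ℤ.+ c ℤ.- ℤ.+ d) ℤ.+ ℤ.+ y ≡ ℤ.+ x
ℤ-recurrence x a b c d y eq = begin
  (ℤ.+ a ℤ.+ ℤ.+ b) ℤ.- (ℤ.+ c ℤ.- ℤ.+ d) ℤ.+ ℤ.+ y ≡⟨ collect (ℤ.+ a) (ℤ.+ b) (ℤ.+ c) (ℤ.+ d) (ℤ.+ y) ⟩
  ℤ.+ (a + b + d + y) ℤ.- ℤ.+ c                    ≡⟨ cong (λ z → ℤ.+ z ℤ.- ℤ.+ c) (sym eq) ⟩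
  ℤ.+ x ℤ.+ ℤ.+ c ℤ.- ℤ.+ c                        ≡⟨ cancel (ℤ.+ x) (ℤ.+ c) ⟩
  ℤ.+ x                                            ∎
  where
  open ≡-Reasoning
  collect : ∀ a b c d y → (a ℤ.+ b) ℤ.- (c ℤ.- d) ℤ.+ y ≡ a ℤ.+ b ℤ.+ d ℤ.+ y ℤ.- c
  collect = ℤSolver.solve-∀
  cancel : ∀ x c → x ℤ.+ c ℤ.- c ≡ x
  cancel = ℤSolver.solve-∀

recurrence-preserves-coeff : ∀ p q (A B C : Poly) →
  (∀ k → A k ≡ ℤ.+ coeff k p (suc q)) →
  (∀ k → B k ≡ ℤ.+ coeff k (suc p) q) →
  (∀ k → C k ≡ ℤ.+ coeff k p q) →
  ∀ k → (((A +ₚ B) -ₚ 1-t·ₚ C) +ₚ (∣ suc p - suc q ∣ ·ₚ t·ₚ (W (suc p) (suc q)))) k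
        ≡ ℤ.+ coeff k (suc p) (suc q)
recurrence-preserves-coeff p q A B C hA hB hC zero
  rewrite hA 0 | hB 0 | hC 0 = cong (ℤ._+_ (ℤ.+ 0)) (ℤ.*-zeroʳ (ℤ.+ ∣ p - q ∣))
recurrence-preserves-coeff p q A B C hA hB hC (suc j)
  rewrite hA (suc j) | hB (suc j) | hC (suc j) | hC j | W-suc p q j
        | sym (ℤ.pos-* ∣ p - q ∣ (Wcoeff p q j))
  = ℤ-recurrence (coeff (suc j) (suc p) (suc q)) (coeff (suc j) p (suc q)) (coeff (suc j) (suc p) q)
                 (coeff (suc j) p q) (coeff j p q) (∣ p - q ∣ * Wcoeff p q j) (coeff-recurrence j p q)

N≡coeff : ∀ p q k → N p q k ≡ ℤ.+ coeff k p q
N≡coeff zero          q             zero          = refl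
N≡coeff zero          q             (suc k)       =
  cong ℤ.+_ (sym (coeff-vanishes (suc k) 0 q (inj₁ z<s)))
N≡coeff (suc p)       zero          zero          = refl
N≡coeff (suc p)       zero          (suc k)       =
  cong ℤ.+_ (sym (coeff-vanishes (suc k) (suc p) 0 (inj₂ z<s)))
N≡coeff 1             1             zero          = refl
N≡coeff 1             1             1             = refl
N≡coeff 1             1             (suc (suc k)) =
  cong ℤ.+_ (sym (coeff-vanishes (suc (suc k)) 1 1 (inj₁ (s≤s z<s))))
N≡coeff 1             (suc (suc q)) k             =
  recurrence-preserves-coeff 0 (suc q) _ _ _
    (N≡coeff 0 (suc (suc q))) (N≡coeff 1 (suc q)) (N≡coeff 0 (suc q)) k
N≡coeff (suc (suc p)) (suc q)       k             =
  recurrence-preserves-coeff (suc p) q _ _ _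
    (N≡coeff (suc p) (suc q)) (N≡coeff (suc (suc p)) q) (N≡coeff (suc p) q) k

sumₚ-++ : ∀ fs gs k → sumₚ (fs ++ gs) k ≡ sumₚ fs k ℤ.+ sumₚ gs k
sumₚ-++ []       gs k = sym (ℤ.+-identityˡ _)
sumₚ-++ (f ∷ fs) gs k = trans (cong (ℤ._+_ (f k)) (sumₚ-++ fs gs k)) (sym (ℤ.+-assoc (f k) _ _))

sumₚ-monomials-zero : ∀ (c : ℕ → ℤ) is → sumₚ (map (λ i → mono (suc i) (c i)) is) 0 ≡ ℤ.+ 0
sumₚ-monomials-zero c []       = refl
sumₚ-monomials-zero c (i ∷ is) = trans (ℤ.+-identityˡ _) (sumₚ-monomials-zero c is)

if-<ᵇ-suc : ∀ (c : ℕ → ℤ) j n →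
  (if j <ᵇ n then c j else ℤ.+ 0) ℤ.+ (if n ≡ᵇ j then c n else ℤ.+ 0)
    ≡ (if j <ᵇ suc n then c j else ℤ.+ 0)
if-<ᵇ-suc c j n with <-cmp j n
... | tri< j<n _ _
  rewrite dec-true (j <? n) j<n | dec-false (n ≟ j) (>⇒≢ j<n) | dec-true (j <? suc n) (m<n⇒m<1+n j<n)
  = ℤ.+-identityʳ (c j)
... | tri≈ _ refl _
  rewrite dec-false (j <? j) (<-irrefl refl) | dec-true (j ≟ j) refl | dec-true (j <? suc j) (n<1+n j)
  = ℤ.+-identityˡ (c j)
... | tri> _ _ n<j
  rewrite dec-false (j <? n) (<⇒≯ n<j) | dec-false (n ≟ j) (<⇒≢ n<j)
        | dec-false (j <? suc n) (<⇒≱ n<j ∘ ≤-pred)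
  = refl

sumₚ-monomials : ∀ (c : ℕ → ℤ) n j →
  sumₚ (map (λ i → mono (suc i) (c i)) (upTo n)) (suc j) ≡ (if j <ᵇ n then c j else ℤ.+ 0)
sumₚ-monomials c zero    j = refl
sumₚ-monomials c (suc n) j = begin
  sumₚ (map f (upTo (suc n))) (suc j)
    ≡⟨ cong (λ is → sumₚ (map f is) (suc j)) (sym (upTo-∷ʳ n)) ⟩
  sumₚ (map f (upTo n ++ [ n ])) (suc j)
    ≡⟨ cong (λ fs → sumₚ fs (suc j)) (map-++ f (upTo n) [ n ]) ⟩
  sumₚ (map f (upTo n) ++ [ f n ]) (suc j)
    ≡⟨ sumₚ-++ (map f (upTo n)) [ f n ] (suc j) ⟩
  sumₚ (map f (upTo n)) (suc j) ℤ.+ (f n (suc j) ℤ.+ ℤ.+ 0)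
    ≡⟨ cong₂ ℤ._+_ (sumₚ-monomials c n j) (ℤ.+-identityʳ _) ⟩
  (if j <ᵇ n then c j else ℤ.+ 0) ℤ.+ f n (suc j)
    ≡⟨ if-<ᵇ-suc c j n ⟩
  (if j <ᵇ suc n then c j else ℤ.+ 0) ∎
  where
  open ≡-Reasoning
  f : ℕ → Poly
  f i = mono (suc i) (c i)

RHS≡coeff : ∀ p q k → RHS p q k ≡ ℤ.+ coeff k p q
RHS≡coeff p q zero    = sumₚ-monomials-zero _ (upTo (p ⊓ q))
RHS≡coeff p q (suc j) = trans (sumₚ-monomials c (p ⊓ q) j) (select (j <? p ⊓ q))
  where
  open ≡-Reasoning
  c : ℕ → ℤ
  c i = ℤ.+ S⊖ (suc i) (p ∸ suc i) (suc i) (q ∸ suc i)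
  select : Dec (j < p ⊓ q) → (if j <ᵇ p ⊓ q then c j else ℤ.+ 0) ≡ ℤ.+ coeff (suc j) p q
  select (yes j<p⊓q) = begin
    (if j <ᵇ p ⊓ q then c j else ℤ.+ 0)
      ≡⟨ cong (λ b → if b then c j else ℤ.+ 0) (dec-true (j <? p ⊓ q) j<p⊓q) ⟩
    ℤ.+ S⊖ (suc j) (p ∸ suc j) (suc j) (q ∸ suc j)
      ≡⟨ cong ℤ.+_ (S⊖-diagonal (suc j) (p ∸ suc j) (q ∸ suc j)) ⟩
    ℤ.+ symDiffTotal (suc j) (p ∸ suc j) (q ∸ suc j)
      ≡⟨ cong ℤ.+_ (sym (coeff≡symDiffTotal (≤-trans j<p⊓q (m⊓n≤m p q))
                                            (≤-trans j<p⊓q (m⊓n≤n p q)))) ⟩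
    ℤ.+ coeff (suc j) p q ∎
  select (no j≮p⊓q) = begin
    (if j <ᵇ p ⊓ q then c j else ℤ.+ 0)
      ≡⟨ cong (λ b → if b then c j else ℤ.+ 0) (dec-false (j <? p ⊓ q) j≮p⊓q) ⟩
    ℤ.+ 0
      ≡⟨ cong ℤ.+_ (sym (coeff-vanishes (suc j) p q (Sum.map bound bound (⊓-sel p q)))) ⟩
    ℤ.+ coeff (suc j) p q ∎
    where
    bound : ∀ {r} → p ⊓ q ≡ r → r < suc j
    bound e = s≤s (subst (_≤ j) e (≮⇒≥ j≮p⊓q))

theorem3p1 : (p q k : ℕ) → N p q k ≡ RHS p q k
theorem3p1 p q k = trans (N≡coeff p q k) (sym (RHS≡coeff p q k))
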